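{- Let $\eta$ be any positive equivalence relation such that there is at least one finitely learnable $\eta$-family. Then there is an $\eta$-family that is confidently learnable but not finitely learnable.
   Context: A positive equivalence relation is an equivalence relation $\eta$ on $\mathbb{N}$ that is recursively enumerable (as a set of pairs) and has infinitely many equivalence classes. A set is $\eta$-closed if it is a union of $\eta$-classes. An $\eta$-family is an infinite family of $\eta$-closed sets possessing a uniformly r.e. one-one numbering $B_0,B_1,\dots$ (i.e. $\{\langle k,x\rangle:x\in B_k\}$ is r.e. and $B_i\neq B_j$ for $i\ne j$). $W_0,W_1,\dots$ is a fixed acceptable numbering of the r.e. sets. A text for $L$ is a total $T:\mathbb N\to\mathbb N\cup\{\#\}$ whose range minus $\{\#\}$ is $L$; $T[n]$ is its initial segment of length $n$. A learner is a recursive function $M$ from finite sequences over $\mathbb N\cup\{\#\}$ to $\mathbb N\cup\{?\}$; an output $e$ is interpreted as the hypothesis "the $\eta$-closure of $W_e$". A family $\mathcal C$ is explanatorily learnable if some $M$, on every text $T$ for every $L\in\mathcal C$, outputs from some point on a single index whose hypothesis equals $L$; confidently learnable if some $M$ explanatorily learns $\mathcal C$ and on every text for every set $L\subseteq\mathbb N$ the sequence $M(T[n])$ converges; finitely learnable if some $M$, on every text $T$ for every $L\in\mathcal C$, has an $n$ with $M(T[m])=?$ for all $m<n$, $M(T[j])=M(T[n])$ for all $j\ge n$, and the hypothesis of $M(T[n])$ equal to $L$. -}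

module Defs where

open import Level using (0ℓ)
open import Data.Nat using (ℕ; zero; suc; _+_; _≤_; _<_)
open import Data.Product using (Σ; ∃; ∃-syntax; _×_; _,_; proj₁; proj₂)
open import Data.Maybe using (Maybe; just; nothing; _>>=_)
open import Data.List using (List; []; _∷_; applyUpTo)
open import Data.List.Relation.Unary.All using (All)
open import Relation.Binary.PropositionalEquality using (_≡_)
open import Relation.Binary.Structures using (IsEquivalence)
open import Relation.Nullary using (¬_)

tri : ℕ → ℕ
tri zero    = zero
tri (suc n) = suc n + tri n

pair : ℕ → ℕ → ℕ
pair x y = tri (x + y) + y

-- enumeration of ℕ × ℕ along anti-diagonals: the inverse of pair
stepPair : ℕ × ℕ → ℕ × ℕ
stepPair (zero  , y) = (suc y , zero)
stepPair (suc x , y) = (x , suc y)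

unpair : ℕ → ℕ × ℕ
unpair zero    = (zero , zero)
unpair (suc n) = stepPair (unpair n)

fst snd : ℕ → ℕ
fst z = proj₁ (unpair z)
snd z = proj₂ (unpair z)

-- A Turing-complete model of unary partial recursive functions
-- (multi-argument functions via pairing)

data Prog : Set where
  zero' succ' id' fst' snd' : Prog
  pair' comp rec : Prog → Prog → Prog
  mu : Prog → Prog

mutual
  eval : ℕ → Prog → ℕ → Maybe ℕ
  eval zero    _            _ = nothing
  eval (suc k) zero'        x = just zero
  eval (suc k) succ'        x = just (suc x)
  eval (suc k) id'          x = just x
  eval (suc k) fst'         x = just (fst x)
  eval (suc k) snd'         x = just (snd x)
  eval (suc k) (pair' f g)  x = eval k f x >>= λ a → eval k g x >>= λ b → just (pair a b)
  eval (suc k) (comp f g)   x = eval k g x >>= eval k f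
  -- rec f g ⟨n,x⟩ : n = 0 ↦ f x ; n+1 ↦ g ⟨⟨n,x⟩, rec f g ⟨n,x⟩⟩
  eval (suc k) (rec f g)    x = recAux k f g (fst x) (snd x)
  -- mu f x = least n with f ⟨n,x⟩ = 0 (all earlier values defined)
  eval (suc k) (mu f)       x = search k f x zero

  recAux : ℕ → Prog → Prog → ℕ → ℕ → Maybe ℕ
  recAux k f g zero    x = eval k f x
  recAux k f g (suc n) x = recAux k f g n x >>= λ r → eval k g (pair (pair n x) r)

  search : ℕ → Prog → ℕ → ℕ → Maybe ℕ
  search zero    f x n = nothing
  search (suc k) f x n = searchStep k f x n (eval k f (pair n x))

  searchStep : ℕ → Prog → ℕ → ℕ → Maybe ℕ → Maybe ℕ
  searchStep k f x n nothing        = nothing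
  searchStep k f x n (just zero)    = just n
  searchStep k f x n (just (suc _)) = search k f x (suc n)

-- effective Gödel numbering of programs (surjective ℕ → Prog)
mutual
  decode' : ℕ → ℕ → Prog
  decode' zero    _ = zero'
  decode' (suc f) n = decTag f (fst n) (snd n)

  decTag : ℕ → ℕ → ℕ → Prog
  decTag f 0 a = zero'
  decTag f 1 a = succ'
  decTag f 2 a = id'
  decTag f 3 a = fst'
  decTag f 4 a = snd'
  decTag f 5 a = pair' (decode' f (fst a)) (decode' f (snd a))
  decTag f 6 a = comp  (decode' f (fst a)) (decode' f (snd a))
  decTag f 7 a = rec   (decode' f (fst a)) (decode' f (snd a))
  decTag f 8 a = mu (decode' f a)
  decTag f _ a = zero'

decode : ℕ → Prog
decode n = decode' (suc n) n

_⟦_⟧↓_ : ℕ → ℕ → ℕ → Set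
e ⟦ x ⟧↓ y = ∃[ k ] eval k (decode e) x ≡ just y

Pred : Set₁
Pred = ℕ → Set

_≐_ : Pred → Pred → Set
A ≐ B = ∀ x → (A x → B x) × (B x → A x)

W : ℕ → Pred
W e x = ∃[ y ] e ⟦ x ⟧↓ y

RE : Pred → Set
RE A = ∃[ e ] A ≐ W e

InfinitelyManyClasses : (ℕ → ℕ → Set) → Set
InfinitelyManyClasses η = ∀ (l : List ℕ) → ∃[ x ] All (λ y → ¬ η x y) l

record Positive (η : ℕ → ℕ → Set) : Set where
  field
    isEquivalence : IsEquivalence η
    re            : RE (λ z → η (fst z) (snd z))
    infClasses    : InfinitelyManyClasses η

Closed : (ℕ → ℕ → Set) → Pred → Set
Closed η A = ∀ x y → η x y → A x → A y

record Family (η : ℕ → ℕ → Set) (B : ℕ → Pred) : Set where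
  field
    closed    : ∀ k → Closed η (B k)
    uniformRE : RE (λ z → B (fst z) (snd z))
    oneOne    : ∀ i j → ¬ i ≡ j → ¬ (B i ≐ B j)

-- nothing = #
Text : (ℕ → Maybe ℕ) → Pred → Set
Text T L = ∀ x → (L x → ∃[ n ] T n ≡ just x) × (∃[ n ] T n ≡ just x → L x)

-- initial segment T[n] = (T 0, …, T (n-1))
seg : (ℕ → Maybe ℕ) → ℕ → List (Maybe ℕ)
seg T n = applyUpTo T n

codeM : Maybe ℕ → ℕ
codeM nothing  = zero
codeM (just x) = suc x

codeSeq : List (Maybe ℕ) → ℕ
codeSeq []      = zero
codeSeq (a ∷ s) = suc (pair (codeM a) (codeSeq s))

-- a learner: a recursive function from finite sequences over ℕ ∪ {#}
-- to ℕ ∪ {?} (nothing = ?)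
record Learner : Set where
  field
    run       : List (Maybe ℕ) → Maybe ℕ
    recursive : ∃[ m ] (∀ σ → m ⟦ codeSeq σ ⟧↓ codeM (run σ))
open Learner public

Hyp : (ℕ → ℕ → Set) → ℕ → Pred
Hyp η e x = ∃[ y ] η x y × W e y

ExLearns : (ℕ → ℕ → Set) → Learner → Pred → Set
ExLearns η M L = ∀ (T : ℕ → Maybe ℕ) → Text T L →
  ∃[ e ] ∃[ n ] ((∀ m → n ≤ m → run M (seg T m) ≡ just e) × (Hyp η e ≐ L))

ExLearnable : (ℕ → ℕ → Set) → (ℕ → Pred) → Set
ExLearnable η B = ∃[ M ] (∀ k → ExLearns η M (B k))

ConfidentlyLearnable : (ℕ → ℕ → Set) → (ℕ → Pred) → Set₁
ConfidentlyLearnable η B = ∃[ M ]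
  ((∀ k → ExLearns η M (B k)) ×
   (∀ (L : Pred) (T : ℕ → Maybe ℕ) → Text T L →
      ∃[ n ] (∀ m → n ≤ m → run M (seg T m) ≡ run M (seg T n))))

FinLearns : (ℕ → ℕ → Set) → Learner → Pred → Set
FinLearns η M L = ∀ (T : ℕ → Maybe ℕ) → Text T L →
  ∃[ n ] ((∀ m → m < n → run M (seg T m) ≡ nothing) ×
          (∃[ e ] (run M (seg T n) ≡ just e ×
                   (∀ j → n ≤ j → run M (seg T j) ≡ run M (seg T n)) ×
                   (Hyp η e ≐ L))))

FinitelyLearnable : (ℕ → ℕ → Set) → (ℕ → Pred) → Set
FinitelyLearnable η B = ∃[ M ] (∀ k → FinLearns η M (B k))

-- Replace the first member of the given family B by ∅.  The result is not finitely learnable: once a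
-- finite learner has committed on the blank text (necessarily to ∅), a text for any other set it learns
-- can be delayed by that many blanks, which forces the same commitment, so that set is empty too.  The
-- same argument shows every member of B is nonempty, so the new family is still one-one.  It is
-- confidently learnable by freezing the finite learner M of B: conjecture ∅ until a datum has appeared,
-- then keep the first conjecture of M from that point on.  The output changes at most once on any text,
-- and on a text for a nonempty B k the conjecture kept is the one M commits to.
module Submission where

open import Defs
open import Level using (0ℓ)
open import Axiom.ExcludedMiddle using (ExcludedMiddle)
open import Data.Nat
  using (ℕ; zero; suc; pred; _+_; _∸_; _≤_; _<_; _⊔_; z≤n; s≤s; _≤′_; ≤′-refl; ≤′-step; _<?_; _≤?_)
open import Data.Nat.Properties
open import Data.Product using (Σ; ∃-syntax; _×_; _,_; proj₁; proj₂)
open import Data.Sum using (_⊎_; inj₁; inj₂)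
open import Data.Maybe using (Maybe; just; nothing; _>>=_)
open import Data.Maybe.Properties using (just-injective)
open import Data.List using (List; []; _∷_; _∷ʳ_; length; foldl; reverse; reverseAcc; applyUpTo)
open import Data.List.Properties using (applyUpTo-∷ʳ; foldl-∷ʳ; unfold-reverse; reverse-involutive)
open import Data.Empty using (⊥; ⊥-elim)
open import Function using (_∘′_)
open import Relation.Binary.PropositionalEquality
open import Relation.Nullary using (¬_; yes; no)

pair-sucʳ : ∀ x y → pair x (suc y) ≡ suc (pair (suc x) y)
pair-sucʳ x y = begin
  tri (x + suc y) + suc y   ≡⟨ cong (λ t → tri t + suc y) (+-suc x y) ⟩
  tri (suc x + y) + suc y   ≡⟨ +-suc (tri (suc x + y)) y ⟩
  suc (tri (suc x + y) + y) ∎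
  where open ≡-Reasoning

pair-sucˡ-0 : ∀ x → pair (suc x) 0 ≡ suc (pair 0 x)
pair-sucˡ-0 x = begin
  tri (suc x + 0) + 0 ≡⟨ +-identityʳ _ ⟩
  tri (suc x + 0)     ≡⟨ cong tri (+-identityʳ (suc x)) ⟩
  suc (x + tri x)     ≡⟨ cong suc (+-comm x (tri x)) ⟩
  suc (tri x + x)     ∎
  where open ≡-Reasoning

pair-stepPair : ∀ p → pair (proj₁ (stepPair p)) (proj₂ (stepPair p)) ≡ suc (pair (proj₁ p) (proj₂ p))
pair-stepPair (zero  , y) = pair-sucˡ-0 y
pair-stepPair (suc x , y) = pair-sucʳ x y

pair-unpair : ∀ n → pair (fst n) (snd n) ≡ n
pair-unpair zero    = refl
pair-unpair (suc n) = trans (pair-stepPair (unpair n)) (cong suc (pair-unpair n))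

unpair-pair : ∀ x y → unpair (pair x y) ≡ (x , y)
unpair-pair x y = go _ x y refl
  where
  go : ∀ n x y → pair x y ≡ n → unpair n ≡ (x , y)
  go zero    zero    zero    _  = refl
  go zero    zero    (suc y) eq with () ← trans (sym (pair-sucʳ 0 y)) eq
  go zero    (suc x) zero    eq with () ← trans (sym (pair-sucˡ-0 x)) eq
  go zero    (suc x) (suc y) eq with () ← trans (sym (pair-sucʳ (suc x) y)) eq
  go (suc n) x       (suc y) eq
    rewrite go n (suc x) y (suc-injective (trans (sym (pair-sucʳ x y)) eq)) = refl
  go (suc n) (suc x) zero    eq
    rewrite go n 0 x (suc-injective (trans (sym (pair-sucˡ-0 x)) eq)) = refl

fst-pair : ∀ x y → fst (pair x y) ≡ x
fst-pair x y = cong proj₁ (unpair-pair x y)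

snd-pair : ∀ x y → snd (pair x y) ≡ y
snd-pair x y = cong proj₂ (unpair-pair x y)

n≤tri : ∀ n → n ≤ tri n
n≤tri zero    = z≤n
n≤tri (suc n) = m≤m+n (suc n) (tri n)

fst≤pair : ∀ x y → x ≤ pair x y
fst≤pair x y = ≤-trans (m≤m+n x y) (≤-trans (n≤tri (x + y)) (m≤m+n _ y))

snd≤pair : ∀ x y → y ≤ pair x y
snd≤pair x y = m≤n+m y (tri (x + y))

suc-preserved⇒≤-preserved : ∀ {P : ℕ → Set} → (∀ {k} → P k → P (suc k)) →
                            ∀ {k k'} → k ≤ k' → P k → P k'
suc-preserved⇒≤-preserved {P} step k≤k' = go (≤⇒≤′ k≤k')
  where
  go : ∀ {k k'} → k ≤′ k' → P k → P k'
  go ≤′-refl        p = p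
  go (≤′-step k≤k') p = step (go k≤k' p)

mutual
  eval-mono : ∀ k p x {y} → eval k p x ≡ just y → eval (suc k) p x ≡ just y
  eval-mono (suc k) zero'       x e = e
  eval-mono (suc k) succ'       x e = e
  eval-mono (suc k) id'         x e = e
  eval-mono (suc k) fst'        x e = e
  eval-mono (suc k) snd'        x e = e
  eval-mono (suc k) (pair' f g) x e with eval k f x in ef | eval k g x in eg
  ... | just a | just b rewrite eval-mono k f x ef | eval-mono k g x eg = e
  eval-mono (suc k) (comp f g)  x e with eval k g x in eg
  ... | just a rewrite eval-mono k g x eg = eval-mono k f a e
  eval-mono (suc k) (rec f g)   x e = recAux-mono k f g (fst x) (snd x) e
  eval-mono (suc k) (mu f)      x e = search-mono k f x 0 e

  recAux-mono : ∀ k f g n x {y} → recAux k f g n x ≡ just y → recAux (suc k) f g n x ≡ just y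
  recAux-mono k f g zero    x e = eval-mono k f x e
  recAux-mono k f g (suc n) x e with recAux k f g n x in er
  ... | just r rewrite recAux-mono k f g n x er = eval-mono k g _ e

  search-mono : ∀ k f x n {y} → search k f x n ≡ just y → search (suc k) f x n ≡ just y
  search-mono (suc k) f x n e with eval k f (pair n x) in ef
  ... | just zero    rewrite eval-mono k f (pair n x) ef = e
  ... | just (suc _) rewrite eval-mono k f (pair n x) ef = search-mono k f x (suc n) e

eval-mono-≤ : ∀ p x {k k' y} → k ≤ k' → eval k p x ≡ just y → eval k' p x ≡ just y
eval-mono-≤ p x {y = y} = suc-preserved⇒≤-preserved {λ k → eval k p x ≡ just y} (eval-mono _ p x)

recAux-mono-≤ : ∀ f g n x {k k' y} → k ≤ k' → recAux k f g n x ≡ just y → recAux k' f g n x ≡ just y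
recAux-mono-≤ f g n x {y = y} = suc-preserved⇒≤-preserved {λ k → recAux k f g n x ≡ just y} (recAux-mono _ f g n x)

eval-functional : ∀ p x {k k' y y'} → eval k p x ≡ just y → eval k' p x ≡ just y' → y ≡ y'
eval-functional p x {k} {k'} e e' = just-injective (trans
  (sym (eval-mono-≤ p x (m≤m⊔n k k') e)) (eval-mono-≤ p x (m≤n⊔m k k') e'))

-- Computable functions

_Computes_ : Prog → (ℕ → ℕ) → Set
p Computes f = ∀ x → ∃[ k ] eval k p x ≡ just (f x)

Computable : (ℕ → ℕ) → Set
Computable f = Σ Prog (_Computes f)

cExt : ∀ {f g} → f ≗ g → Computable f → Computable g
cExt f≗g (p , cp) = p , λ x → proj₁ (cp x) , trans (proj₂ (cp x)) (cong just (f≗g x))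

cZero : Computable (λ _ → 0)
cZero = zero' , λ _ → 1 , refl

cSuc : Computable suc
cSuc = succ' , λ _ → 1 , refl

cId : Computable (λ x → x)
cId = id' , λ _ → 1 , refl

cFst : Computable fst
cFst = fst' , λ _ → 1 , refl

cSnd : Computable snd
cSnd = snd' , λ _ → 1 , refl

cComp : ∀ {f g} → Computable f → Computable g → Computable (λ x → f (g x))
cComp {f} {g} (pf , cf) (pg , cg) = comp pf pg , λ x →
  let (k₁ , e₁) = cg x ; (k₂ , e₂) = cf (g x) in
  suc (k₁ ⊔ k₂) , trans (cong (_>>= eval (k₁ ⊔ k₂) pf) (eval-mono-≤ pg x (m≤m⊔n k₁ k₂) e₁))
                        (eval-mono-≤ pf (g x) (m≤n⊔m k₁ k₂) e₂)

cPair : ∀ {f g} → Computable f → Computable g → Computable (λ x → pair (f x) (g x))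
cPair {f} {g} (pf , cf) (pg , cg) = pair' pf pg , λ x →
  let (k₁ , e₁) = cf x ; (k₂ , e₂) = cg x in
  suc (k₁ ⊔ k₂) , both {k₁ ⊔ k₂} (eval-mono-≤ pf x (m≤m⊔n k₁ k₂) e₁)
                                 (eval-mono-≤ pg x (m≤n⊔m k₁ k₂) e₂)
  where
  both : ∀ {k x} → eval k pf x ≡ just (f x) → eval k pg x ≡ just (g x) →
         eval (suc k) (pair' pf pg) x ≡ just (pair (f x) (g x))
  both e₁ e₂ rewrite e₁ | e₂ = refl

cConst : ∀ n → Computable (λ _ → n)
cConst zero    = cZero
cConst (suc n) = cComp cSuc (cConst n)

primRec : (ℕ → ℕ) → (ℕ → ℕ) → ℕ → ℕ → ℕ
primRec f g zero    x = f x
primRec f g (suc n) x = g (pair (pair n x) (primRec f g n x))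

cPrimRec : ∀ {f g a b} → Computable f → Computable g → Computable a → Computable b →
           Computable (λ x → primRec f g (a x) (b x))
cPrimRec {f} {g} {a} {b} (pf , cf) (pg , cg) ca cb =
  cExt (λ x → cong₂ (primRec f g) (fst-pair (a x) (b x)) (snd-pair (a x) (b x)))
       (cComp (rec pf pg , λ z → let (k , e) = recAux-computes (fst z) (snd z) in suc k , e) (cPair ca cb))
  where
  recAux-computes : ∀ n x → ∃[ k ] recAux k pf pg n x ≡ just (primRec f g n x)
  recAux-computes zero    x = cf x
  recAux-computes (suc n) x =
    let (k₁ , e₁) = recAux-computes n x ; (k₂ , e₂) = cg (pair (pair n x) (primRec f g n x)) in
    k₁ ⊔ k₂ , trans (cong (_>>= λ r → eval (k₁ ⊔ k₂) pg (pair (pair n x) r))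
                          (recAux-mono-≤ pf pg n x (m≤m⊔n k₁ k₂) e₁))
                    (eval-mono-≤ pg _ (m≤n⊔m k₁ k₂) e₂)

ifz : ℕ → ℕ → ℕ → ℕ
ifz zero    x y = x
ifz (suc _) x y = y

cIfz : ∀ {b x y} → Computable b → Computable x → Computable y → Computable (λ z → ifz (b z) (x z) (y z))
cIfz {b} {x} {y} cb cx cy =
  cExt select (cPrimRec cFst (cComp cSnd (cComp cSnd cFst)) cb (cPair cx cy))
  where
  select : ∀ z → primRec fst (λ w → snd (snd (fst w))) (b z) (pair (x z) (y z)) ≡ ifz (b z) (x z) (y z)
  select z with b z
  ... | zero  = fst-pair (x z) (y z)
  ... | suc n rewrite fst-pair (pair n (pair (x z) (y z))) (primRec fst (λ w → snd (snd (fst w))) n (pair (x z) (y z)))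
                    | snd-pair n (pair (x z) (y z)) = snd-pair (x z) (y z)

cPred : Computable pred
cPred = cExt predecessor (cPrimRec cZero (cComp cFst cFst) cId cZero)
  where
  predecessor : ∀ n → primRec (λ _ → 0) (λ w → fst (fst w)) n 0 ≡ pred n
  predecessor zero    = refl
  predecessor (suc n) rewrite fst-pair (pair n 0) (primRec (λ _ → 0) (λ w → fst (fst w)) n 0) = fst-pair n 0

⌜_⌝ : Prog → ℕ
⌜ zero'     ⌝ = 0
⌜ succ'     ⌝ = pair 1 0
⌜ id'       ⌝ = pair 2 0
⌜ fst'      ⌝ = pair 3 0
⌜ snd'      ⌝ = pair 4 0
⌜ pair' p q ⌝ = pair 5 (pair ⌜ p ⌝ ⌜ q ⌝)
⌜ comp p q  ⌝ = pair 6 (pair ⌜ p ⌝ ⌜ q ⌝)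
⌜ rec p q   ⌝ = pair 7 (pair ⌜ p ⌝ ⌜ q ⌝)
⌜ mu p      ⌝ = pair 8 ⌜ p ⌝

snd<pair-suc : ∀ n x → x < pair (suc n) x
snd<pair-suc n x = s≤s (m≤n+m x (n + x + tri (n + x)))

fst<pair-suc-pair : ∀ n a b → a < pair (suc n) (pair a b)
fst<pair-suc-pair n a b = ≤-trans (s≤s (fst≤pair a b)) (snd<pair-suc n (pair a b))

snd<pair-suc-pair : ∀ n a b → b < pair (suc n) (pair a b)
snd<pair-suc-pair n a b = ≤-trans (s≤s (snd≤pair a b)) (snd<pair-suc n (pair a b))

decode'-⌜⌝ : ∀ p f → ⌜ p ⌝ < f → decode' f ⌜ p ⌝ ≡ p
decode'-⌜⌝ zero'       (suc f) _ = refl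
decode'-⌜⌝ succ'       (suc f) _ = refl
decode'-⌜⌝ id'         (suc f) _ = refl
decode'-⌜⌝ fst'        (suc f) _ = refl
decode'-⌜⌝ snd'        (suc f) _ = refl
decode'-⌜⌝ (pair' p q) (suc f) (s≤s lt)
  rewrite fst-pair 5 (pair ⌜ p ⌝ ⌜ q ⌝) | snd-pair 5 (pair ⌜ p ⌝ ⌜ q ⌝)
        | fst-pair ⌜ p ⌝ ⌜ q ⌝ | snd-pair ⌜ p ⌝ ⌜ q ⌝ =
  cong₂ pair' (decode'-⌜⌝ p f (≤-trans (fst<pair-suc-pair 4 ⌜ p ⌝ ⌜ q ⌝) lt))
              (decode'-⌜⌝ q f (≤-trans (snd<pair-suc-pair 4 ⌜ p ⌝ ⌜ q ⌝) lt))
decode'-⌜⌝ (comp p q)  (suc f) (s≤s lt)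
  rewrite fst-pair 6 (pair ⌜ p ⌝ ⌜ q ⌝) | snd-pair 6 (pair ⌜ p ⌝ ⌜ q ⌝)
        | fst-pair ⌜ p ⌝ ⌜ q ⌝ | snd-pair ⌜ p ⌝ ⌜ q ⌝ =
  cong₂ comp (decode'-⌜⌝ p f (≤-trans (fst<pair-suc-pair 5 ⌜ p ⌝ ⌜ q ⌝) lt))
             (decode'-⌜⌝ q f (≤-trans (snd<pair-suc-pair 5 ⌜ p ⌝ ⌜ q ⌝) lt))
decode'-⌜⌝ (rec p q)   (suc f) (s≤s lt)
  rewrite fst-pair 7 (pair ⌜ p ⌝ ⌜ q ⌝) | snd-pair 7 (pair ⌜ p ⌝ ⌜ q ⌝)
        | fst-pair ⌜ p ⌝ ⌜ q ⌝ | snd-pair ⌜ p ⌝ ⌜ q ⌝ =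
  cong₂ rec (decode'-⌜⌝ p f (≤-trans (fst<pair-suc-pair 6 ⌜ p ⌝ ⌜ q ⌝) lt))
            (decode'-⌜⌝ q f (≤-trans (snd<pair-suc-pair 6 ⌜ p ⌝ ⌜ q ⌝) lt))
decode'-⌜⌝ (mu p)      (suc f) (s≤s lt)
  rewrite fst-pair 8 ⌜ p ⌝ | snd-pair 8 ⌜ p ⌝ =
  cong mu (decode'-⌜⌝ p f (≤-trans (snd<pair-suc 7 ⌜ p ⌝) lt))

decode-⌜⌝ : ∀ p → decode ⌜ p ⌝ ≡ p
decode-⌜⌝ p = decode'-⌜⌝ p (suc ⌜ p ⌝) ≤-refl

⌜⌝-computes : ∀ {p f} → p Computes f → ∀ x → ⌜ p ⌝ ⟦ x ⟧↓ f x
⌜⌝-computes {p} cp x rewrite decode-⌜⌝ p = cp x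

Halts : Prog → Pred
Halts p x = ∃[ y ] ∃[ k ] eval k p x ≡ just y

W-⌜⌝ : ∀ p → W ⌜ p ⌝ ≐ Halts p
W-⌜⌝ p x rewrite decode-⌜⌝ p = (λ h → h) , (λ h → h)

search-diverges : ∀ {p f x} → p Computes f → (∀ n → f (pair n x) ≢ 0) →
                  ∀ k n {v} → search k p x n ≢ just v
search-diverges {p} {f} {x} cp f≢0 (suc k) n e with eval k p (pair n x) in ep
... | just zero    = f≢0 n (sym (eval-functional p (pair n x) {k} {proj₁ (cp (pair n x))} ep (proj₂ (cp (pair n x)))))
... | just (suc _) = search-diverges cp f≢0 k (suc n) e

mu-diverges : ∀ {p f x} → p Computes f → (∀ n → f (pair n x) ≢ 0) → ¬ Halts (mu p) x
mu-diverges cp f≢0 (_ , suc k , e) = search-diverges cp f≢0 k 0 e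

mu-halts : ∀ {p f x} → p Computes f → f (pair 0 x) ≡ 0 → Halts (mu p) x
mu-halts {p} {f} {x} cp f≡0 with cp (pair 0 x)
... | k , e = 0 , suc (suc k) , found
  where
  found : searchStep k p x 0 (eval k p (pair 0 x)) ≡ just 0
  found rewrite e | f≡0 = refl

loop : Prog
loop = mu succ'

loop-diverges : ∀ x → ¬ Halts loop x
loop-diverges x = mu-diverges (proj₂ cSuc) (λ _ ())

meet : Prog → Prog → Prog
meet a b = comp fst' (pair' a b)

meet-halts : ∀ {a b x} → Halts a x → Halts b x → Halts (meet a b) x
meet-halts {a} {b} {x} (y , k₁ , e₁) (w , k₂ , e₂) = fst (pair y w) , suc (suc (k₁ ⊔ k₂)) , both
  where
  both : eval (suc (suc (k₁ ⊔ k₂))) (meet a b) x ≡ just (fst (pair y w))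
  both rewrite eval-mono-≤ a x (m≤m⊔n k₁ k₂) e₁ | eval-mono-≤ b x (m≤n⊔m k₁ k₂) e₂ = refl

halts-meet : ∀ {a b x} → Halts (meet a b) x → Halts a x × Halts b x
halts-meet {a} {b} {x} (y , suc (suc k) , e) with eval k a x in e₁ | eval k b x in e₂
... | just v | just w = (v , k , e₁) , (w , k , e₂)

-- On ⟨n , z⟩ the test vanishes iff fst z ≢ 0, so the search for a zero halts exactly on those z.
fstZeroTest : ℕ → ℕ
fstZeroTest w = ifz (fst (snd w)) 1 0

cFstZeroTest : Computable fstZeroTest
cFstZeroTest = cIfz (cComp cFst cSnd) (cConst 1) (cConst 0)

haltsIfFstNonZero : Prog
haltsIfFstNonZero = mu (proj₁ cFstZeroTest)

haltsIfFstNonZero-halts : ∀ {z k} → fst z ≡ suc k → Halts haltsIfFstNonZero z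
haltsIfFstNonZero-halts {z} fz =
  mu-halts (proj₂ cFstZeroTest) (cong (λ w → ifz w 1 0) (trans (cong fst (snd-pair 0 z)) fz))

haltsIfFstNonZero-diverges : ∀ {z} → fst z ≡ 0 → ¬ Halts haltsIfFstNonZero z
haltsIfFstNonZero-diverges {z} fz = mu-diverges (proj₂ cFstZeroTest) test≢0
  where
  test≢0 : ∀ n → fstZeroTest (pair n z) ≢ 0
  test≢0 n rewrite snd-pair n z | fz = λ ()

decodeM : ℕ → Maybe ℕ
decodeM zero    = nothing
decodeM (suc x) = just x

codeM-decodeM : ∀ n → codeM (decodeM n) ≡ n
codeM-decodeM zero    = refl
codeM-decodeM (suc n) = refl

-- The first argument is fuel; fuel n suffices for the code n.
decodeSeq' : ℕ → ℕ → List (Maybe ℕ)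
decodeSeq' zero    _       = []
decodeSeq' (suc f) zero    = []
decodeSeq' (suc f) (suc n) = decodeM (fst n) ∷ decodeSeq' f (snd n)

decodeSeq : ℕ → List (Maybe ℕ)
decodeSeq n = decodeSeq' n n

codeSeq-decodeSeq' : ∀ f n → n ≤ f → codeSeq (decodeSeq' f n) ≡ n
codeSeq-decodeSeq' zero    zero    _        = refl
codeSeq-decodeSeq' (suc f) zero    _        = refl
codeSeq-decodeSeq' (suc f) (suc n) (s≤s n≤f)
  rewrite codeM-decodeM (fst n)
        | codeSeq-decodeSeq' f (snd n) (≤-trans (≤-trans (snd≤pair (fst n) (snd n)) (≤-reflexive (pair-unpair n)))
                                                n≤f) =
  cong suc (pair-unpair n)

codeSeq-decodeSeq : ∀ n → codeSeq (decodeSeq n) ≡ n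
codeSeq-decodeSeq n = codeSeq-decodeSeq' n n ≤-refl

length≤codeSeq : ∀ xs → length xs ≤ codeSeq xs
length≤codeSeq []       = z≤n
length≤codeSeq (a ∷ xs) = s≤s (≤-trans (length≤codeSeq xs) (snd≤pair (codeM a) (codeSeq xs)))

module CodedFold (S : ℕ → ℕ) (cS : Computable S) (init : ℕ) where

  step : ℕ → Maybe ℕ → ℕ
  step s a = S (pair s (codeM a))

  -- One step on a pair ⟨accumulator , code of the remaining sequence⟩; the empty code is a fixed point.
  consume : ℕ → ℕ
  consume p = ifz (snd p) p (pair (S (pair (fst p) (fst (pred (snd p))))) (snd (pred (snd p))))

  iter : ℕ → ℕ → ℕ
  iter zero    p = p
  iter (suc n) p = consume (iter n p)

  iter-suc : ∀ n p → iter (suc n) p ≡ iter n (consume p)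
  iter-suc zero    p = refl
  iter-suc (suc n) p = cong consume (iter-suc n p)

  iter-done : ∀ n s → iter n (pair s 0) ≡ pair s 0
  iter-done zero    s = refl
  iter-done (suc n) s rewrite iter-done n s | snd-pair s 0 = refl

  iter-consumes : ∀ xs s n → length xs ≤ n → iter n (pair s (codeSeq xs)) ≡ pair (foldl step s xs) 0
  iter-consumes []       s n       _ = iter-done n s
  iter-consumes (a ∷ xs) s (suc n) (s≤s len≤n)
    rewrite iter-suc n (pair s (codeSeq (a ∷ xs)))
          | snd-pair s (codeSeq (a ∷ xs)) | fst-pair s (codeSeq (a ∷ xs))
          | fst-pair (codeM a) (codeSeq xs) | snd-pair (codeM a) (codeSeq xs) =
    iter-consumes xs (step s a) n len≤n

  primRec-iter : ∀ n x → primRec (pair init) (λ w → consume (snd w)) n x ≡ iter n (pair init x)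
  primRec-iter zero    x = refl
  primRec-iter (suc n) x rewrite snd-pair (pair n x) (primRec (pair init) (λ w → consume (snd w)) n x) =
    cong consume (primRec-iter n x)

  foldCode : ℕ → ℕ
  foldCode c = fst (primRec (pair init) (λ w → consume (snd w)) c c)

  cFoldCode : Computable foldCode
  cFoldCode = cComp cFst (cPrimRec (cPair (cConst init) cId) (cComp cConsume cSnd) cId cId)
    where
    cConsume : Computable consume
    cConsume = cIfz cSnd cId (cPair (cComp cS (cPair cFst (cComp cFst (cComp cPred cSnd))))
                                    (cComp cSnd (cComp cPred cSnd)))

  foldCode-codeSeq : ∀ xs → foldCode (codeSeq xs) ≡ foldl step init xs
  foldCode-codeSeq xs
    rewrite primRec-iter (codeSeq xs) (codeSeq xs) | iter-consumes xs init (codeSeq xs) (length≤codeSeq xs) =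
    fst-pair (foldl step init xs) 0

-- ⟨code of σ , code of a⟩ ↦ code of a ∷ σ
consCode : ℕ → ℕ
consCode w = suc (pair (snd w) (fst w))

module ReverseCode = CodedFold consCode (cComp cSuc (cPair cSnd cFst)) 0

reverseCode : ℕ → ℕ
reverseCode = ReverseCode.foldCode

cReverseCode : Computable reverseCode
cReverseCode = ReverseCode.cFoldCode

reverseCode-codeSeq : ∀ xs → reverseCode (codeSeq xs) ≡ codeSeq (reverse xs)
reverseCode-codeSeq xs = trans (ReverseCode.foldCode-codeSeq xs) (fold-reverseAcc [] xs)
  where
  fold-reverseAcc : ∀ acc ys → foldl ReverseCode.step (codeSeq acc) ys ≡ codeSeq (reverseAcc acc ys)
  fold-reverseAcc acc []       = refl
  fold-reverseAcc acc (a ∷ ys) rewrite snd-pair (codeSeq acc) (codeM a) | fst-pair (codeSeq acc) (codeM a) =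
    fold-reverseAcc (a ∷ acc) ys

runCode : Learner → ℕ → ℕ
runCode M n = codeM (run M (decodeSeq n))

cRunCode : ∀ M → Computable (runCode M)
cRunCode M = decode m , λ n → subst (λ c → ∃[ k ] eval k (decode m) c ≡ just (runCode M n))
                                    (codeSeq-decodeSeq n) (computes (decodeSeq n))
  where
  m = proj₁ (recursive M)
  computes = proj₂ (recursive M)

runCode-codeSeq : ∀ M σ → runCode M (codeSeq σ) ≡ codeM (run M σ)
runCode-codeSeq M σ with proj₂ (cRunCode M) (codeSeq σ) | proj₂ (recursive M) σ
... | k₁ , e₁ | k₂ , e₂ = eval-functional (decode (proj₁ (recursive M))) (codeSeq σ) {k₁} {k₂} e₁ e₂

learner : (F : ℕ → ℕ) → Computable F → Learner
learner F (p , cp) = record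
  { run       = λ σ → decodeM (F (codeSeq σ))
  ; recursive = ⌜ p ⌝ , λ σ → subst (⌜ p ⌝ ⟦ codeSeq σ ⟧↓_) (sym (codeM-decodeM (F (codeSeq σ))))
                                     (⌜⌝-computes cp (codeSeq σ))
  }

Empty : Pred → Set
Empty L = ∀ x → ¬ L x

inhabited : ∀ {L} → ExcludedMiddle 0ℓ → ¬ Empty L → ∃[ x ] L x
inhabited {L} lem nonempty with lem {∃[ x ] L x}
... | yes witness = witness
... | no none     = ⊥-elim (nonempty λ x Lx → none (x , Lx))

blank : ℕ → Maybe ℕ
blank _ = nothing

blank-Text : ∀ {L} → Empty L → Text blank L
blank-Text empty x = (λ Lx → ⊥-elim (empty x Lx)) , λ ()

Text-Empty⇒blank : ∀ {T L} → Text T L → Empty L → ∀ n → T n ≡ nothing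
Text-Empty⇒blank {T} text empty n with T n in eq
... | nothing = refl
... | just x  = ⊥-elim (empty x (proj₂ (text x) (n , eq)))

module _ (lem : ExcludedMiddle 0ℓ) where

  textOf : Pred → ℕ → Maybe ℕ
  textOf L n with lem {L n}
  ... | yes _ = just n
  ... | no _  = nothing

  textOf-Text : ∀ L → Text (textOf L) L
  textOf-Text L x = (λ Lx → x , listed Lx) , λ (n , eq) → sound n eq
    where
    listed : L x → textOf L x ≡ just x
    listed Lx with lem {L x}
    ... | yes _   = refl
    ... | no ¬Lx = ⊥-elim (¬Lx Lx)
    sound : ∀ n → textOf L n ≡ just x → L x
    sound n eq with lem {L n}
    sound n refl | yes Ln = Ln

delay : ℕ → (ℕ → Maybe ℕ) → ℕ → Maybe ℕ
delay n T k with k <? n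
... | yes _ = nothing
... | no _  = T (k ∸ n)

delay-Text : ∀ {T L} n → Text T L → Text (delay n T) L
delay-Text {T} {L} n text x = (λ Lx → let (k , eq) = proj₁ (text x) Lx in k + n , listed k eq) , sound
  where
  listed : ∀ k → T k ≡ just x → delay n T (k + n) ≡ just x
  listed k eq with k + n <? n
  ... | yes k+n<n = ⊥-elim (<⇒≱ k+n<n (m≤n+m n k))
  ... | no _ rewrite m+n∸n≡m k n = eq
  sound : (∃[ k ] delay n T k ≡ just x) → L x
  sound (k , eq) with k <? n
  ... | no _ = proj₂ (text x) (k ∸ n , eq)

seg-cong : ∀ {T T'} n → (∀ i → i < n → T i ≡ T' i) → seg T n ≡ seg T' n
seg-cong         zero    _  = refl
seg-cong {T} {T'} (suc n) eq =
  cong₂ _∷_ (eq 0 (s≤s z≤n)) (seg-cong {T ∘′ suc} {T' ∘′ suc} n (λ i i<n → eq (suc i) (s≤s i<n)))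

reverse-∷-reverse-seg : ∀ T m → reverse (T m ∷ reverse (seg T m)) ≡ seg T (suc m)
reverse-∷-reverse-seg T m = begin
  reverse (T m ∷ reverse (seg T m))    ≡⟨ unfold-reverse (T m) (reverse (seg T m)) ⟩
  reverse (reverse (seg T m)) ∷ʳ T m   ≡⟨ cong (_∷ʳ T m) (reverse-involutive (seg T m)) ⟩
  seg T m ∷ʳ T m                       ≡⟨ applyUpTo-∷ʳ T m ⟩
  seg T (suc m)                        ∎
  where open ≡-Reasoning

seg-delay : ∀ {T j} n → j ≤ n → seg (delay n T) j ≡ seg blank j
seg-delay {T} {j} n j≤n = seg-cong j early
  where
  early : ∀ i → i < j → delay n T i ≡ nothing
  early i i<j with i <? n
  ... | yes _  = refl
  ... | no i≮n = ⊥-elim (i≮n (<-≤-trans i<j j≤n))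

-- Finite learning

-- On the text for L delayed by n blanks, M commits at stage n, to its commitment on the blank text.
finLearns-Empty : ∀ {η M L₀ L} → ExcludedMiddle 0ℓ →
                  FinLearns η M L₀ → Empty L₀ → FinLearns η M L → Empty L
finLearns-Empty {η} {M} {L₀} {L} lem fin₀ empty₀ fin x Lx
  with fin₀ blank (blank-Text empty₀)
... | n , _ , e , commit , _ , hyp₀
  with fin (delay n (textOf lem L)) (delay-Text n (textOf-Text lem L))
... | n' , silent , e' , commit' , stays , hyp =
  empty₀ x (proj₁ (hyp₀ x) (subst (λ i → Hyp η i x) e'≡e (proj₂ (hyp x) Lx)))
  where
  T = delay n (textOf lem L)
  atN : run M (seg T n) ≡ just e
  atN = trans (cong (run M) (seg-delay n ≤-refl)) commit
  e'≡e : e' ≡ e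
  e'≡e with n' ≤? n
  ... | yes n'≤n = just-injective (trans (sym commit') (trans (sym (stays n n'≤n)) atN))
  ... | no n'≰n  with () ← trans (sym (silent n (≰⇒> n'≰n))) atN

family-nonempty : ∀ {η B M} → ExcludedMiddle 0ℓ → Family η B → (∀ k → FinLearns η M (B k)) →
                  ∀ k → ¬ Empty (B k)
family-nonempty {B = B} {M} lem family fin k empty =
  Family.oneOne family k (suc k) (λ k≡1+k → 1+n≢n (sym k≡1+k))
    (λ x → (λ Bkx → ⊥-elim (empty x Bkx)) , (λ B1+kx → ⊥-elim (next-empty x B1+kx)))
  where
  next-empty : Empty (B (suc k))
  next-empty = finLearns-Empty {M = M} lem (fin k) empty (fin (suc k))

withEmpty : (ℕ → Pred) → ℕ → Pred
withEmpty B zero    _ = ⊥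
withEmpty B (suc k) = B (suc k)

withEmpty-Family : ∀ {η B} → Family η B → (∀ k → ¬ Empty (B k)) → Family η (withEmpty B)
withEmpty-Family {η} {B} family nonempty = record
  { closed    = closed
  ; uniformRE = ⌜ enumerator ⌝ , λ z → listed z , sound z ∘′ proj₁ (W-⌜⌝ enumerator z)
  ; oneOne    = oneOne
  }
  where
  closed : ∀ k → Closed η (withEmpty B k)
  closed zero    _ _ _ ()
  closed (suc k) = Family.closed family (suc k)

  u = proj₁ (Family.uniformRE family)
  enumerates = proj₂ (Family.uniformRE family)

  enumerator : Prog
  enumerator = meet (decode u) haltsIfFstNonZero

  listed : ∀ z → withEmpty B (fst z) (snd z) → W ⌜ enumerator ⌝ z
  listed z Cz = proj₂ (W-⌜⌝ enumerator z) (halts (fst z) refl Cz)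
    where
    halts : ∀ i → fst z ≡ i → withEmpty B i (snd z) → Halts enumerator z
    halts (suc k) fz Bz = meet-halts (proj₁ (enumerates z) (subst (λ i → B i (snd z)) (sym fz) Bz))
                                     (haltsIfFstNonZero-halts fz)

  sound : ∀ z → Halts enumerator z → withEmpty B (fst z) (snd z)
  sound z h = member (fst z) refl (halts-meet h)
    where
    member : ∀ i → fst z ≡ i → Halts (decode u) z × Halts haltsIfFstNonZero z → withEmpty B i (snd z)
    member zero    fz (_ , stops)   = haltsIfFstNonZero-diverges fz stops
    member (suc k) fz (listsB , _) = subst (λ i → B i (snd z)) fz (proj₂ (enumerates z) listsB)

  oneOne : ∀ i j → i ≢ j → ¬ (withEmpty B i ≐ withEmpty B j)
  oneOne zero    zero    i≢j _   = i≢j refl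
  oneOne zero    (suc j) _   C≐C = nonempty (suc j) (λ x → proj₂ (C≐C x))
  oneOne (suc i) zero    _   C≐C = nonempty (suc i) (λ x → proj₁ (C≐C x))
  oneOne (suc i) (suc j) i≢j     = Family.oneOne family (suc i) (suc j) i≢j

withEmpty-not-FinitelyLearnable : ∀ {η B} → ExcludedMiddle 0ℓ → (∀ k → ¬ Empty (B k)) →
                                  ¬ FinitelyLearnable η (withEmpty B)
withEmpty-not-FinitelyLearnable lem nonempty (M , fin) =
  nonempty 1 (finLearns-Empty {M = M} lem (fin 0) (λ _ ()) (fin 1))

-- Freezing a finite learner

module Freeze (M : Learner) where

  -- seen T m ≢ 0 iff T[m] contains a datum; frozen T m is 0 (undecided) or 1 + the first guess of M
  -- on a prefix T[j], j ≤ m, that contains a datum.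
  seen : (ℕ → Maybe ℕ) → ℕ → ℕ
  seen T zero    = 0
  seen T (suc m) = ifz (codeM (T m)) (seen T m) 1

  frozen : (ℕ → Maybe ℕ) → ℕ → ℕ
  frozen T zero    = 0
  frozen T (suc m) = ifz (frozen T m) (ifz (seen T (suc m)) 0 (codeM (run M (seg T (suc m))))) (frozen T m)

  -- While undecided, conjecture ∅: loop halts nowhere.
  hypothesis : ℕ → ℕ
  hypothesis zero    = ⌜ loop ⌝
  hypothesis (suc e) = e

  -- The state ⟨frozen , ⟨seen , code of the reversed prefix⟩⟩ after reading one more symbol.
  freezeStep : ℕ → ℕ
  freezeStep w =
    let res = fst (fst w) ; fl = fst (snd (fst w)) ; r = snd (snd (fst w)) ; a = snd w
        fl' = ifz a fl 1 ; r' = suc (pair a r)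
    in pair (ifz res (ifz fl' 0 (runCode M (reverseCode r'))) res) (pair fl' r')

  cFreezeStep : Computable freezeStep
  cFreezeStep = cPair (cIfz cRes (cIfz cFl' (cConst 0) (cComp (cRunCode M) (cComp cReverseCode cR'))) cRes)
                      (cPair cFl' cR')
    where
    cRes = cComp cFst cFst
    cFl  = cComp cFst (cComp cSnd cFst)
    cR   = cComp cSnd (cComp cSnd cFst)
    cFl' = cIfz cSnd cFl (cConst 1)
    cR'  = cComp cSuc (cPair cSnd cR)

  freezeStep-pair : ∀ res fl r a → freezeStep (pair (pair res (pair fl r)) a) ≡
    pair (ifz res (ifz (ifz a fl 1) 0 (runCode M (reverseCode (suc (pair a r))))) res)
         (pair (ifz a fl 1) (suc (pair a r)))
  freezeStep-pair res fl r a
    rewrite fst-pair (pair res (pair fl r)) a | snd-pair (pair res (pair fl r)) a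
          | fst-pair res (pair fl r) | snd-pair res (pair fl r) | fst-pair fl r | snd-pair fl r = refl

  module FreezeFold = CodedFold freezeStep cFreezeStep 0

  cHypothesis : Computable hypothesis
  cHypothesis = cExt choose (cIfz cId (cConst ⌜ loop ⌝) cPred)
    where
    choose : ∀ r → ifz r ⌜ loop ⌝ (pred r) ≡ hypothesis r
    choose zero    = refl
    choose (suc _) = refl

  freeze : Learner
  freeze = learner (λ c → suc (hypothesis (fst (FreezeFold.foldCode c))))
                   (cComp cSuc (cComp cHypothesis (cComp cFst FreezeFold.cFoldCode)))

  freezeFold-seg : ∀ T m → foldl FreezeFold.step 0 (seg T m) ≡
                           pair (frozen T m) (pair (seen T m) (codeSeq (reverse (seg T m))))
  freezeFold-seg T zero    = refl
  freezeFold-seg T (suc m) = begin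
    foldl FreezeFold.step 0 (seg T (suc m))
      ≡⟨ cong (foldl FreezeFold.step 0) (sym (applyUpTo-∷ʳ T m)) ⟩
    foldl FreezeFold.step 0 (seg T m ∷ʳ T m)
      ≡⟨ foldl-∷ʳ FreezeFold.step 0 (T m) (seg T m) ⟩
    freezeStep (pair (foldl FreezeFold.step 0 (seg T m)) a)
      ≡⟨ cong (λ s → freezeStep (pair s a)) (freezeFold-seg T m) ⟩
    freezeStep (pair (pair (frozen T m) (pair (seen T m) r)) a)
      ≡⟨ freezeStep-pair (frozen T m) (seen T m) r a ⟩
    pair (ifz (frozen T m) (ifz (seen T (suc m)) 0 (runCode M (reverseCode r'))) (frozen T m)) (pair (seen T (suc m)) r')
      ≡⟨ cong₂ (λ u v → pair (ifz (frozen T m) (ifz (seen T (suc m)) 0 u) (frozen T m)) (pair (seen T (suc m)) v))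
               guess reversed ⟩
    pair (frozen T (suc m)) (pair (seen T (suc m)) (codeSeq (reverse (seg T (suc m))))) ∎
    where
    open ≡-Reasoning
    a = codeM (T m)
    r = codeSeq (reverse (seg T m))
    r' = suc (pair a r)
    guess : runCode M (reverseCode r') ≡ codeM (run M (seg T (suc m)))
    guess = begin
      runCode M (reverseCode (codeSeq (T m ∷ reverse (seg T m))))
        ≡⟨ cong (runCode M) (reverseCode-codeSeq (T m ∷ reverse (seg T m))) ⟩
      runCode M (codeSeq (reverse (T m ∷ reverse (seg T m))))     ≡⟨ cong (runCode M ∘′ codeSeq) (reverse-∷-reverse-seg T m) ⟩
      runCode M (codeSeq (seg T (suc m)))                         ≡⟨ runCode-codeSeq M (seg T (suc m)) ⟩
      codeM (run M (seg T (suc m)))                               ∎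
    reversed : r' ≡ codeSeq (reverse (seg T (suc m)))
    reversed = cong codeSeq (trans (sym (reverse-involutive (T m ∷ reverse (seg T m))))
                                   (cong reverse (reverse-∷-reverse-seg T m)))

  run-freeze : ∀ T m → run freeze (seg T m) ≡ just (hypothesis (frozen T m))
  run-freeze T m = cong (just ∘′ hypothesis) (begin
    fst (FreezeFold.foldCode (codeSeq (seg T m)))  ≡⟨ cong fst (FreezeFold.foldCode-codeSeq (seg T m)) ⟩
    fst (foldl FreezeFold.step 0 (seg T m))        ≡⟨ cong fst (freezeFold-seg T m) ⟩
    fst (pair (frozen T m) (pair (seen T m) _))    ≡⟨ fst-pair (frozen T m) _ ⟩
    frozen T m                                     ∎)
    where open ≡-Reasoning

  frozen-stable : ∀ T {m j v} → m ≤ j → frozen T m ≡ suc v → frozen T j ≡ suc v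
  frozen-stable T {v = v} = suc-preserved⇒≤-preserved {λ m → frozen T m ≡ suc v} (λ {m} → stays {m})
    where
    stays : ∀ {m} → frozen T m ≡ suc v → frozen T (suc m) ≡ suc v
    stays eq rewrite eq = refl

  frozen-converges : ExcludedMiddle 0ℓ → ∀ T → ∃[ n ] (∀ m → n ≤ m → frozen T m ≡ frozen T n)
  frozen-converges lem T with lem {∃[ m ] ∃[ v ] frozen T m ≡ suc v}
  ... | yes (n , v , eq) = n , λ m n≤m → trans (frozen-stable T n≤m eq) (sym eq)
  ... | no never         = 0 , λ m _ → undecided m
    where
    undecided : ∀ m → frozen T m ≡ 0
    undecided m with frozen T m in eq
    ... | zero  = refl
    ... | suc v = ⊥-elim (never (m , v , eq))

  frozen-blank : ∀ {T} → (∀ n → T n ≡ nothing) → ∀ m → frozen T m ≡ 0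
  frozen-blank {T} blankT m = undecided m
    where
    unseen : ∀ m → seen T m ≡ 0
    unseen zero    = refl
    unseen (suc m) rewrite blankT m = unseen m
    undecided : ∀ m → frozen T m ≡ 0
    undecided zero    = refl
    undecided (suc m) rewrite undecided m | unseen (suc m) = refl

  seen-after : ∀ {T p x} → T p ≡ just x → ∀ m → p < m → seen T m ≡ 1
  seen-after {T} {p} Tp m p<m = suc-preserved⇒≤-preserved {λ m → seen T m ≡ 1} stays p<m first
    where
    first : seen T (suc p) ≡ 1
    first rewrite Tp = refl
    stays : ∀ {m} → seen T m ≡ 1 → seen T (suc m) ≡ 1
    stays {m} eq with codeM (T m)
    ... | zero  = eq
    ... | suc _ = refl

  frozen-values : ∀ {T e} → (∀ m → run M (seg T m) ≡ nothing ⊎ run M (seg T m) ≡ just e) →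
                  ∀ m → frozen T m ≡ 0 ⊎ frozen T m ≡ suc e
  frozen-values answers zero = inj₁ refl
  frozen-values {T} answers (suc m) with frozen-values answers m
  ... | inj₂ eq rewrite eq = inj₂ refl
  ... | inj₁ eq rewrite eq with seen T (suc m) | answers (suc m)
  ...   | zero  | _          = inj₁ refl
  ...   | suc _ | inj₁ quiet = inj₁ (cong codeM quiet)
  ...   | suc _ | inj₂ guess = inj₂ (cong codeM guess)

  frozen-locks : ∀ {T e} → (∀ m → run M (seg T m) ≡ nothing ⊎ run M (seg T m) ≡ just e) →
                 ∀ m → seen T (suc m) ≡ 1 → run M (seg T (suc m)) ≡ just e → frozen T (suc m) ≡ suc e
  frozen-locks answers m seen1 guess with frozen-values answers m
  ... | inj₁ eq rewrite eq | seen1 | guess = refl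
  ... | inj₂ eq rewrite eq = refl

  freeze-converges : ExcludedMiddle 0ℓ → ∀ T →
                     ∃[ n ] (∀ m → n ≤ m → run freeze (seg T m) ≡ run freeze (seg T n))
  freeze-converges lem T with frozen-converges lem T
  ... | n , stable = n , λ m n≤m →
    trans (run-freeze T m) (trans (cong (just ∘′ hypothesis) (stable m n≤m)) (sym (run-freeze T n)))

  freeze-learns-Empty : ∀ {η L} → Empty L → ExLearns η freeze L
  freeze-learns-Empty {η} {L} empty T text = ⌜ loop ⌝ , 0 , undecided , hyp
    where
    undecided : ∀ m → 0 ≤ m → run freeze (seg T m) ≡ just ⌜ loop ⌝
    undecided m _ = trans (run-freeze T m) (cong (just ∘′ hypothesis) (frozen-blank (Text-Empty⇒blank text empty) m))
    hyp : Hyp η ⌜ loop ⌝ ≐ L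
    hyp x = (λ (y , _ , Wy) → ⊥-elim (loop-diverges y (proj₁ (W-⌜⌝ loop y) Wy))) ,
            (λ Lx → ⊥-elim (empty x Lx))

  freeze-learns : ∀ {η L} → FinLearns η M L → ∃[ x ] L x → ExLearns η freeze L
  freeze-learns {η} {L} fin (x , Lx) T text with fin T text | proj₁ (text x) Lx
  ... | n , silent , e , commit , stays , hyp | p , Tp = e , suc (p ⊔ n) , locked , hyp
    where
    answers : ∀ m → run M (seg T m) ≡ nothing ⊎ run M (seg T m) ≡ just e
    answers m with n ≤? m
    ... | yes n≤m = inj₂ (trans (stays m n≤m) commit)
    ... | no n≰m  = inj₁ (silent m (≰⇒> n≰m))
    lock : frozen T (suc (p ⊔ n)) ≡ suc e
    lock = frozen-locks answers (p ⊔ n) (seen-after Tp (suc (p ⊔ n)) (s≤s (m≤m⊔n p n)))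
                        (trans (stays _ (m≤n⇒m≤1+n (m≤n⊔m p n))) commit)
    locked : ∀ m → suc (p ⊔ n) ≤ m → run freeze (seg T m) ≡ just e
    locked m le = trans (run-freeze T m) (cong (just ∘′ hypothesis) (frozen-stable T le lock))

theorem5 : ExcludedMiddle 0ℓ → (η : ℕ → ℕ → Set) → Positive η →
    (∃[ B ] (Family η B × FinitelyLearnable η B)) →
    ∃[ B ] (Family η B × ConfidentlyLearnable η B × ¬ FinitelyLearnable η B)
theorem5 lem η _ (B , family , M , fin) =
  withEmpty B , withEmpty-Family family nonempty ,
  (freeze , learns , λ _ T _ → freeze-converges lem T) ,
  withEmpty-not-FinitelyLearnable lem nonempty
  where
  open Freeze M
  nonempty : ∀ k → ¬ Empty (B k)
  nonempty = family-nonempty {M = M} lem family fin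
  learns : ∀ k → ExLearns η freeze (withEmpty B k)
  learns zero    = freeze-learns-Empty (λ _ ())
  learns (suc k) = freeze-learns (fin (suc k)) (inhabited lem (nonempty (suc k)))
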